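{- Let $n,p$ be positive integers and let $k$ be a nonnegative integer. Then \[c(n+kp+1,k,p,p-1)=\sum_{j_1+j_2+\cdots+j_{k+1}=n}c(j_1+1,p)\,c(j_2+1,p)\cdots c(j_{k+1}+1,p),\] where the sum is taken over all integer tuples $(j_1,\dots,j_{k+1})$ with $j_t\geq -1$ for $t=1,2,\ldots,k+1$ and $j_1+\cdots+j_{k+1}=n$.
   Context: For positive integers $m,p$, $c(m,p)$ denotes the number of compositions of $m$ (ordered sequences of positive integers summing to $m$) in which all parts are $\geq p$; by convention $c(0,p)=1$. For integers $m\ge 1$, $p\ge1$, $k\ge 0$, $c(m,k,p,p-1)$ denotes the number of compositions of $m$ in which exactly $k$ parts are equal to $p-1$ and all other parts are $\geq p$ (when $p=1$ these are weak compositions, parts equal to $0$ being allowed, with exactly $k$ parts equal to $0$). -}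

module Defs where

open import Data.Nat using (ℕ; zero; suc; _+_; _*_; _∸_; _≤_; _≤?_; _≟_)
open import Data.List using (List; []; _∷_; [_]; map; concatMap; upTo; filter; length)
open import Data.Nat.ListAction using (sum; product)
open import Data.List.Relation.Unary.All using (All; all?)
open import Data.Sum using (_⊎_)
open import Data.Product using (_×_)
open import Relation.Binary.PropositionalEquality using (_≡_)
open import Relation.Nullary using (Dec)
open import Relation.Nullary.Decidable using (_×-dec_; _⊎-dec_)

-- All lists of length ≤ L whose entries lie in {0,…,B} (each exactly once).
listsUpTo : ℕ → ℕ → List (List ℕ)
listsUpTo zero    B = [ [] ]
listsUpTo (suc L) B = [] ∷ concatMap (λ x → map (x ∷_) (listsUpTo L B)) (upTo (suc B))

tuples : ℕ → ℕ → List (List ℕ)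
tuples zero    B = [ [] ]
tuples (suc L) B = concatMap (λ x → map (x ∷_) (tuples L B)) (upTo (suc B))

IsComp : ℕ → ℕ → List ℕ → Set
IsComp m p xs = (sum xs ≡ m) × All (p ≤_) xs

isComp? : ∀ m p xs → Dec (IsComp m p xs)
isComp? m p xs = (sum xs ≟ m) ×-dec all? (p ≤?_) xs

-- c(m,p): number of compositions of m with all parts ≥ p  (p ≥ 1).
-- Such a composition has at most m parts, each ≤ m, so listsUpTo m m
-- contains all of them; c(0,p) = 1 (the empty composition).
c : ℕ → ℕ → ℕ
c m p = length (filter (isComp? m p) (listsUpTo m m))

count : ℕ → List ℕ → ℕ
count a xs = length (filter (_≟ a) xs)

IsComp′ : ℕ → ℕ → ℕ → List ℕ → Set
IsComp′ m k p xs =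
  (sum xs ≡ m) × ((count (p ∸ 1) xs ≡ k) × All (λ x → (x ≡ p ∸ 1) ⊎ (p ≤ x)) xs)

isComp′? : ∀ m k p xs → Dec (IsComp′ m k p xs)
isComp′? m k p xs =
  (sum xs ≟ m) ×-dec ((count (p ∸ 1) xs ≟ k)
    ×-dec all? (λ x → (x ≟ p ∸ 1) ⊎-dec (p ≤? x)) xs)

-- c(m,k,p,p-1), for p ≥ 1.  Such a composition has at most m + k parts
-- (at most k parts equal to 0, the others ≥ 1), each ≤ m.
c′ : ℕ → ℕ → ℕ → ℕ
c′ m k p = length (filter (isComp′? m k p) (listsUpTo (m + k) m))

-- RHS: sum over (j₁,…,j_{k+1}) with j_t ≥ -1, Σ j_t = n, of Π c(j_t + 1, p).
-- Encoded via i_t = j_t + 1 ≥ 0 with Σ i_t = n + k + 1 (so i_t ≤ n + k + 1).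
rhs : ℕ → ℕ → ℕ → ℕ
rhs n k p =
  sum (map (λ is → product (map (λ i → c i p) is))
           (filter (λ is → sum is ≟ n + k + 1) (tuples (suc k) (n + k + 1))))

module Submission where

-- Write p = s + 1, and for a composition call a part equal to s = p - 1
-- "special" and a part ≥ p "ordinary".  Let D k m = c(m,k,p,p-1),
-- C m = c(m,p), and let ⋆ be the convolution of sequences ℕ → ℕ, with unit
-- δ.  Splitting off the first part of a composition gives the recursions
--   D 0 = δ + ordinary ⋆ D 0,   D (k+1) = special ⋆ D k + ordinary ⋆ D (k+1),
-- and C = D 0 (no part is special).  Since ordinary 0 = 0, the equation
-- X = A + ordinary ⋆ X has exactly one solution, namely C ⋆ A; hence
-- D (k+1) = C ⋆ special ⋆ D k.  Convolving with special shifts by s, so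
-- D k (M + k s) = C^{⋆(k+1)} M.  On the other side, the sum over
-- (k+1)-tuples in the theorem is C^{⋆(k+1)} (n+k+1), and
-- n + k p + 1 = (n + k + 1) + k s.

open import Defs
open import Data.Nat using (ℕ; zero; suc; _+_; _*_; _∸_; _≤_; _<_; _≤?_; _≟_; z≤n; s≤s)
open import Data.Nat.Properties
open import Data.Nat.Tactic.RingSolver using (solve-∀)
open import Data.List using (List; []; _∷_; map; concatMap; upTo; filter; length; applyUpTo; _++_)
open import Data.Nat.ListAction using (sum; product)
open import Data.List.Relation.Unary.All using (All; []; _∷_) renaming (map to All-map)
open import Data.Product using (_×_; _,_; proj₁)
open import Data.Sum using (_⊎_; inj₁; inj₂)
open import Data.Empty using (⊥; ⊥-elim)
open import Relation.Binary.PropositionalEquality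
open import Relation.Nullary using (Dec; yes; no; ¬_)
open import Relation.Nullary.Decidable using (_×-dec_; _⊎-dec_)
open import Algebra.Properties.CommutativeSemigroup +-commutativeSemigroup using (interchange)

ind : ∀ {A : Set} → Dec A → ℕ
ind (yes _) = 1
ind (no _)  = 0

ind-yes : ∀ {A : Set} (d : Dec A) → A → ind d ≡ 1
ind-yes (yes _) a = refl
ind-yes (no ¬a) a = ⊥-elim (¬a a)

ind-no : ∀ {A : Set} (d : Dec A) → ¬ A → ind d ≡ 0
ind-no (yes a) ¬a = ⊥-elim (¬a a)
ind-no (no _)  ¬a = refl

ind-iff : ∀ {A B : Set} (a : Dec A) (b : Dec B) → (A → B) → (B → A) → ind a ≡ ind b
ind-iff (yes _) (yes _) f g = refl
ind-iff (yes x) (no ¬y) f g = ⊥-elim (¬y (f x))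
ind-iff (no ¬x) (yes y) f g = ⊥-elim (¬x (g y))
ind-iff (no _)  (no _)  f g = refl

ind-*-cong : ∀ {A : Set} (d : Dec A) {a b : ℕ} → (A → a ≡ b) → ind d * a ≡ ind d * b
ind-*-cong (yes x) f = cong (_+ 0) (f x)
ind-*-cong (no _)  f = refl

W : ∀ {A : Set} {Q : A → Set} → (A → ℕ) → ((x : A) → Dec (Q x)) → List A → ℕ
W w Q? xs = sum (map w (filter Q? xs))

module _ {A : Set} (w : A → ℕ) where

  W-cons : ∀ {Q : A → Set} (Q? : (x : A) → Dec (Q x)) x xs →
           W w Q? (x ∷ xs) ≡ ind (Q? x) * w x + W w Q? xs
  W-cons Q? x xs with Q? x
  ... | yes _ = cong (_+ W w Q? xs) (sym (+-identityʳ (w x)))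
  ... | no _  = refl

  W-++ : ∀ {Q : A → Set} (Q? : (x : A) → Dec (Q x)) xs ys →
         W w Q? (xs ++ ys) ≡ W w Q? xs + W w Q? ys
  W-++ Q? []       ys = refl
  W-++ Q? (x ∷ xs) ys = begin
      W w Q? (x ∷ xs ++ ys)                      ≡⟨ W-cons Q? x (xs ++ ys) ⟩
      ind (Q? x) * w x + W w Q? (xs ++ ys)       ≡⟨ cong (ind (Q? x) * w x +_) (W-++ Q? xs ys) ⟩
      ind (Q? x) * w x + (W w Q? xs + W w Q? ys) ≡⟨ sym (+-assoc (ind (Q? x) * w x) _ _) ⟩
      ind (Q? x) * w x + W w Q? xs + W w Q? ys   ≡⟨ cong (_+ W w Q? ys) (sym (W-cons Q? x xs)) ⟩
      W w Q? (x ∷ xs) + W w Q? ys                ∎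
    where open ≡-Reasoning

  W-equiv : ∀ {P Q : A → Set} (P? : (x : A) → Dec (P x)) (Q? : (x : A) → Dec (Q x)) →
            (∀ x → P x → Q x) → (∀ x → Q x → P x) → ∀ xs → W w P? xs ≡ W w Q? xs
  W-equiv P? Q? f g []       = refl
  W-equiv P? Q? f g (x ∷ xs) = begin
      W w P? (x ∷ xs)              ≡⟨ W-cons P? x xs ⟩
      ind (P? x) * w x + W w P? xs ≡⟨ cong₂ (λ a b → a * w x + b) (ind-iff (P? x) (Q? x) (f x) (g x))
                                                                  (W-equiv P? Q? f g xs) ⟩
      ind (Q? x) * w x + W w Q? xs ≡⟨ sym (W-cons Q? x xs) ⟩
      W w Q? (x ∷ xs)              ∎
    where open ≡-Reasoning

  W-and : ∀ {B : Set} {Q : A → Set} (b : Dec B) (Q? : (x : A) → Dec (Q x)) → ∀ xs →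
          W w (λ z → b ×-dec Q? z) xs ≡ ind b * W w Q? xs
  W-and b Q? []       = sym (*-zeroʳ (ind b))
  W-and b Q? (x ∷ xs) = begin
      W w (λ z → b ×-dec Q? z) (x ∷ xs)
        ≡⟨ W-cons (λ z → b ×-dec Q? z) x xs ⟩
      ind (b ×-dec Q? x) * w x + W w (λ z → b ×-dec Q? z) xs
        ≡⟨ cong₂ _+_ (ind-× b (Q? x)) (W-and b Q? xs) ⟩
      ind b * (ind (Q? x) * w x) + ind b * W w Q? xs
        ≡⟨ sym (*-distribˡ-+ (ind b) _ _) ⟩
      ind b * (ind (Q? x) * w x + W w Q? xs)
        ≡⟨ cong (ind b *_) (sym (W-cons Q? x xs)) ⟩
      ind b * W w Q? (x ∷ xs) ∎
    where
      open ≡-Reasoning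
      ind-× : ∀ {C D : Set} (c : Dec C) (d : Dec D) → ind (c ×-dec d) * w x ≡ ind c * (ind d * w x)
      ind-× (yes _) (yes _) = sym (*-identityˡ (1 * w x))
      ind-× (yes _) (no _)  = refl
      ind-× (no _)  (yes _) = refl
      ind-× (no _)  (no _)  = refl

  W-or : ∀ {P Q : A → Set} (P? : (x : A) → Dec (P x)) (Q? : (x : A) → Dec (Q x)) →
         (∀ x → P x → Q x → ⊥) → ∀ xs →
         W w (λ z → P? z ⊎-dec Q? z) xs ≡ W w P? xs + W w Q? xs
  W-or P? Q? disjoint []       = refl
  W-or P? Q? disjoint (x ∷ xs) = begin
      W w (λ z → P? z ⊎-dec Q? z) (x ∷ xs)
        ≡⟨ W-cons (λ z → P? z ⊎-dec Q? z) x xs ⟩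
      ind (P? x ⊎-dec Q? x) * w x + W w (λ z → P? z ⊎-dec Q? z) xs
        ≡⟨ cong₂ _+_ (ind-⊎ (P? x) (Q? x) (disjoint x)) (W-or P? Q? disjoint xs) ⟩
      (ind (P? x) * w x + ind (Q? x) * w x) + (W w P? xs + W w Q? xs)
        ≡⟨ interchange (ind (P? x) * w x) _ _ _ ⟩
      (ind (P? x) * w x + W w P? xs) + (ind (Q? x) * w x + W w Q? xs)
        ≡⟨ cong₂ _+_ (sym (W-cons P? x xs)) (sym (W-cons Q? x xs)) ⟩
      W w P? (x ∷ xs) + W w Q? (x ∷ xs) ∎
    where
      open ≡-Reasoning
      ind-⊎ : ∀ {C D : Set} (c : Dec C) (d : Dec D) → (C → D → ⊥) →
              ind (c ⊎-dec d) * w x ≡ ind c * w x + ind d * w x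
      ind-⊎ (yes a) (yes b) h = ⊥-elim (h a b)
      ind-⊎ (yes _) (no _)  h = sym (+-identityʳ _)
      ind-⊎ (no _)  (yes _) h = refl
      ind-⊎ (no _)  (no _)  h = refl

W-scale : ∀ {A : Set} {Q : A → Set} (a : ℕ) (w : A → ℕ) (Q? : (x : A) → Dec (Q x)) → ∀ xs →
          W (λ z → a * w z) Q? xs ≡ a * W w Q? xs
W-scale a w Q? []       = sym (*-zeroʳ a)
W-scale a w Q? (x ∷ xs) = begin
    W (λ z → a * w z) Q? (x ∷ xs)                     ≡⟨ W-cons (λ z → a * w z) Q? x xs ⟩
    ind (Q? x) * (a * w x) + W (λ z → a * w z) Q? xs  ≡⟨ cong₂ _+_ (x*[y*z]≡y*[x*z] (ind (Q? x)) a (w x))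
                                                                  (W-scale a w Q? xs) ⟩
    a * (ind (Q? x) * w x) + a * W w Q? xs            ≡⟨ sym (*-distribˡ-+ a _ _) ⟩
    a * (ind (Q? x) * w x + W w Q? xs)                ≡⟨ cong (a *_) (sym (W-cons w Q? x xs)) ⟩
    a * W w Q? (x ∷ xs)                               ∎
  where
    open ≡-Reasoning
    x*[y*z]≡y*[x*z] : ∀ x y z → x * (y * z) ≡ y * (x * z)
    x*[y*z]≡y*[x*z] = solve-∀

length-filter≡W : ∀ {A : Set} {Q : A → Set} (Q? : (x : A) → Dec (Q x)) xs →
                  length (filter Q? xs) ≡ W (λ _ → 1) Q? xs
length-filter≡W Q? xs = length≡sum-ones (filter Q? xs)
  where
    length≡sum-ones : ∀ {A : Set} (ys : List A) → length ys ≡ sum (map (λ _ → 1) ys)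
    length≡sum-ones []       = refl
    length≡sum-ones (y ∷ ys) = cong suc (length≡sum-ones ys)

W-map : ∀ {A B : Set} {Q : B → Set} (w : B → ℕ) (Q? : (x : B) → Dec (Q x)) (g : A → B) → ∀ xs →
        W w Q? (map g xs) ≡ W (λ z → w (g z)) (λ z → Q? (g z)) xs
W-map w Q? g []       = refl
W-map w Q? g (x ∷ xs) = trans (W-cons w Q? (g x) (map g xs))
  (trans (cong (ind (Q? (g x)) * w (g x) +_) (W-map w Q? g xs))
         (sym (W-cons (λ z → w (g z)) (λ z → Q? (g z)) x xs)))

W-concatMap : ∀ {A B : Set} {Q : B → Set} (w : B → ℕ) (Q? : (x : B) → Dec (Q x)) (h : A → List B) → ∀ xs →
              W w Q? (concatMap h xs) ≡ sum (map (λ x → W w Q? (h x)) xs)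
W-concatMap w Q? h []       = refl
W-concatMap w Q? h (x ∷ xs) = trans (W-++ w Q? (h x) (concatMap h xs))
  (cong (W w Q? (h x) +_) (W-concatMap w Q? h xs))

Σ< : ℕ → (ℕ → ℕ) → ℕ
Σ< n h = sum (applyUpTo h n)

sum-upTo : ∀ n (h : ℕ → ℕ) → sum (map h (upTo n)) ≡ Σ< n h
sum-upTo n h = cong sum (map-applyUpTo n (λ x → x))
  where
    map-applyUpTo : ∀ n (f : ℕ → ℕ) → map h (applyUpTo f n) ≡ applyUpTo (λ x → h (f x)) n
    map-applyUpTo zero    f = refl
    map-applyUpTo (suc n) f = cong (h (f 0) ∷_) (map-applyUpTo n (λ x → f (suc x)))

Σ<-cong : ∀ n (h h′ : ℕ → ℕ) → (∀ i → i < n → h i ≡ h′ i) → Σ< n h ≡ Σ< n h′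
Σ<-cong zero    h h′ e = refl
Σ<-cong (suc n) h h′ e = cong₂ _+_ (e 0 (s≤s z≤n))
  (Σ<-cong n (λ i → h (suc i)) (λ i → h′ (suc i)) (λ i lt → e (suc i) (s≤s lt)))

Σ<-zero : ∀ n (h : ℕ → ℕ) → (∀ i → i < n → h i ≡ 0) → Σ< n h ≡ 0
Σ<-zero zero    h e = refl
Σ<-zero (suc n) h e = cong₂ _+_ (e 0 (s≤s z≤n)) (Σ<-zero n (λ i → h (suc i)) (λ i lt → e (suc i) (s≤s lt)))

Σ<-+ : ∀ n (a b : ℕ → ℕ) → Σ< n (λ i → a i + b i) ≡ Σ< n a + Σ< n b
Σ<-+ zero    a b = refl
Σ<-+ (suc n) a b = trans (cong (a 0 + b 0 +_) (Σ<-+ n (λ i → a (suc i)) (λ i → b (suc i))))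
  (interchange (a 0) (b 0) _ _)

Σ<-* : ∀ n c (a : ℕ → ℕ) → Σ< n (λ i → c * a i) ≡ c * Σ< n a
Σ<-* zero    c a = sym (*-zeroʳ c)
Σ<-* (suc n) c a = trans (cong (c * a 0 +_) (Σ<-* n c (λ i → a (suc i)))) (sym (*-distribˡ-+ c (a 0) _))

Σ<-truncate : ∀ m B (g : ℕ → ℕ) → m ≤ B → (∀ x → m < x → g x ≡ 0) → Σ< (suc B) g ≡ Σ< (suc m) g
Σ<-truncate zero    B       g le       z = cong (g 0 +_) (Σ<-zero B (λ i → g (suc i)) (λ i _ → z (suc i) (s≤s z≤n)))
Σ<-truncate (suc m) (suc B) g (s≤s le) z =
  cong (g 0 +_) (Σ<-truncate m B (λ i → g (suc i)) le (λ x lt → z (suc x) (s≤s lt)))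

Σ<-restrict : ∀ m B (h : ℕ → ℕ) → m ≤ B → Σ< (suc B) (λ x → ind (x ≤? m) * h x) ≡ Σ< (suc m) h
Σ<-restrict m B h le =
  trans (Σ<-truncate m B _ le (λ x lt → cong (_* h x) (ind-no (x ≤? m) (<⇒≱ lt))))
        (Σ<-cong (suc m) _ _ (λ i lt → trans (cong (_* h i) (ind-yes (i ≤? m) (≤-pred lt))) (+-identityʳ (h i))))

Σ<-delta : ∀ n s (h : ℕ → ℕ) → s < n → Σ< n (λ i → ind (i ≟ s) * h i) ≡ h s
Σ<-delta (suc n) zero    h lt       = trans
  (cong₂ _+_ (+-identityʳ (h 0)) (Σ<-zero n _ (λ i _ → cong (_* h (suc i)) (ind-no (suc i ≟ 0) (λ ())))))
  (+-identityʳ (h 0))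
Σ<-delta (suc n) (suc s) h (s≤s lt) = trans
  (Σ<-cong n _ _ (λ i _ → cong (_* h (suc i)) (ind-iff (suc i ≟ suc s) (i ≟ s) suc-injective (cong suc))))
  (Σ<-delta n s (λ i → h (suc i)) lt)

-- Convolution of sequences:  (f ⋆ g) m = Σ_{i ≤ m} f i · g (m - i)

δ : ℕ → ℕ
δ zero    = 1
δ (suc _) = 0

infixl 7 _⋆_
_⋆_ : (ℕ → ℕ) → (ℕ → ℕ) → ℕ → ℕ
(f ⋆ g) m = Σ< (suc m) (λ i → f i * g (m ∸ i))

⋆-cong : ∀ m (f f′ g g′ : ℕ → ℕ) → (∀ i → i ≤ m → f i ≡ f′ i) → (∀ j → j ≤ m → g j ≡ g′ j) →
         (f ⋆ g) m ≡ (f′ ⋆ g′) m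
⋆-cong m f f′ g g′ ef eg =
  Σ<-cong (suc m) _ _ (λ i lt → cong₂ _*_ (ef i (≤-pred lt)) (eg (m ∸ i) (m∸n≤m m i)))

⋆-distribʳ-+ : ∀ m (f g h : ℕ → ℕ) → ((λ i → f i + g i) ⋆ h) m ≡ (f ⋆ h) m + (g ⋆ h) m
⋆-distribʳ-+ m f g h = trans
  (Σ<-cong (suc m) _ _ (λ i _ → *-distribʳ-+ (h (m ∸ i)) (f i) (g i)))
  (Σ<-+ (suc m) (λ i → f i * h (m ∸ i)) (λ i → g i * h (m ∸ i)))

⋆-scaleˡ : ∀ m a (f h : ℕ → ℕ) → ((λ i → a * f i) ⋆ h) m ≡ a * (f ⋆ h) m
⋆-scaleˡ m a f h = trans
  (Σ<-cong (suc m) _ _ (λ i _ → *-assoc a (f i) (h (m ∸ i))))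
  (Σ<-* (suc m) a (λ i → f i * h (m ∸ i)))

⋆-identityˡ : ∀ m (g : ℕ → ℕ) → (δ ⋆ g) m ≡ g m
⋆-identityˡ m g = trans (cong₂ _+_ (+-identityʳ (g m)) (Σ<-zero m _ (λ _ _ → refl))) (+-identityʳ (g m))

⋆-identityʳ : ∀ m (f : ℕ → ℕ) → (f ⋆ δ) m ≡ f m
⋆-identityʳ zero    f = trans (+-identityʳ (f 0 * 1)) (*-identityʳ (f 0))
⋆-identityʳ (suc m) f = trans (cong (_+ ((λ i → f (suc i)) ⋆ δ) m) (*-zeroʳ (f 0)))
                              (⋆-identityʳ m (λ i → f (suc i)))

⋆-zeroʳ : ∀ m (f g : ℕ → ℕ) → (∀ j → j ≤ m → g j ≡ 0) → (f ⋆ g) m ≡ 0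
⋆-zeroʳ m f g e = Σ<-zero (suc m) _ (λ i _ → trans (cong (f i *_) (e (m ∸ i) (m∸n≤m m i))) (*-zeroʳ (f i)))

⋆-assoc : ∀ m (f g h : ℕ → ℕ) → (f ⋆ g ⋆ h) m ≡ (f ⋆ (g ⋆ h)) m
⋆-assoc zero    f g h = rearrange₀ (f 0) (g 0) (h 0)
  where
    rearrange₀ : ∀ a b c → (a * b + 0) * c + 0 ≡ a * (b * c + 0) + 0
    rearrange₀ = solve-∀
⋆-assoc (suc m) f g h = begin
    (f ⋆ g) 0 * h (suc m) + ((λ j → f 0 * g (suc j) + (f′ ⋆ g) j) ⋆ h) m
  ≡⟨ cong ((f ⋆ g) 0 * h (suc m) +_) (⋆-distribʳ-+ m (λ j → f 0 * g (suc j)) (f′ ⋆ g) h) ⟩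
    (f ⋆ g) 0 * h (suc m) + (((λ j → f 0 * g (suc j)) ⋆ h) m + (f′ ⋆ g ⋆ h) m)
  ≡⟨ cong ((f ⋆ g) 0 * h (suc m) +_) (cong₂ _+_ (⋆-scaleˡ m (f 0) (λ j → g (suc j)) h) (⋆-assoc m f′ g h)) ⟩
    (f ⋆ g) 0 * h (suc m) + (f 0 * ((λ i → g (suc i)) ⋆ h) m + (f′ ⋆ (g ⋆ h)) m)
  ≡⟨ rearrange (f 0) (g 0) (h (suc m)) _ _ ⟩
    (f ⋆ (g ⋆ h)) (suc m) ∎
  where
    open ≡-Reasoning
    f′ = λ i → f (suc i)
    rearrange : ∀ a b H Y X → (a * b + 0) * H + (a * Y + X) ≡ a * (b * H + Y) + X
    rearrange = solve-∀

⋆-shift : ∀ t M (f g : ℕ → ℕ) → (∀ j → j < t → g j ≡ 0) → (f ⋆ g) (M + t) ≡ (f ⋆ (λ j → g (j + t))) M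
⋆-shift t zero    f g z = cong (f 0 * g t +_)
  (Σ<-zero t _ (λ i lt → trans (cong (f (suc i) *_) (z (t ∸ suc i) (t∸1+i<t t i lt))) (*-zeroʳ (f (suc i)))))
  where
    t∸1+i<t : ∀ t i → i < t → t ∸ suc i < t
    t∸1+i<t (suc t) i (s≤s _) = s≤s (m∸n≤m t i)
⋆-shift t (suc M) f g z = cong (f 0 * g (suc (M + t)) +_) (⋆-shift t M (λ i → f (suc i)) g z)

-- If P 0 = 0, the equation X = A + P ⋆ X has at most one solution:
-- its right-hand side at m only involves X below m.
⋆-equation-unique : ∀ (P A X Y : ℕ → ℕ) → P 0 ≡ 0 →
  (∀ m → X m ≡ A m + (P ⋆ X) m) → (∀ m → Y m ≡ A m + (P ⋆ Y) m) → ∀ m → X m ≡ Y m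
⋆-equation-unique P A X Y P0≡0 eqX eqY m = agree-upto m m ≤-refl
  where
    at-0 : ∀ (Z : ℕ → ℕ) → (∀ m → Z m ≡ A m + (P ⋆ Z) m) → Z 0 ≡ A 0
    at-0 Z eqZ = trans (eqZ 0) (trans (cong (λ z → A 0 + (z * Z 0 + 0)) P0≡0) (+-identityʳ (A 0)))
    at-suc : ∀ (Z : ℕ → ℕ) → (∀ m → Z m ≡ A m + (P ⋆ Z) m) →
             ∀ m → Z (suc m) ≡ A (suc m) + ((λ i → P (suc i)) ⋆ Z) m
    at-suc Z eqZ m = trans (eqZ (suc m))
      (cong (λ z → A (suc m) + (z * Z (suc m) + ((λ i → P (suc i)) ⋆ Z) m)) P0≡0)
    P′ = λ i → P (suc i)
    agree-upto : ∀ m j → j ≤ m → X j ≡ Y j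
    agree-upto zero    zero _ = trans (at-0 X eqX) (sym (at-0 Y eqY))
    agree-upto (suc m) j le with m≤n⇒m<n∨m≡n le
    ... | inj₁ lt   = agree-upto m j (≤-pred lt)
    ... | inj₂ refl = trans (at-suc X eqX m)
      (trans (cong (A (suc m) +_) (⋆-cong m P′ P′ X Y (λ _ _ → refl) (λ j le → agree-upto m j le)))
             (sym (at-suc Y eqY m)))

W-listsUpTo-suc : ∀ {Q : List ℕ → Set} (w : List ℕ → ℕ) (Q? : ∀ xs → Dec (Q xs)) L B →
  W w Q? (listsUpTo (suc L) B) ≡
  ind (Q? []) * w [] + Σ< (suc B) (λ x → W w Q? (map (x ∷_) (listsUpTo L B)))
W-listsUpTo-suc w Q? L B = trans (W-cons w Q? [] _) (cong (ind (Q? []) * w [] +_)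
  (trans (W-concatMap w Q? (λ x → map (x ∷_) (listsUpTo L B)) (upTo (suc B))) (sum-upTo (suc B) _)))

W-tuples-suc : ∀ {Q : List ℕ → Set} (w : List ℕ → ℕ) (Q? : ∀ xs → Dec (Q xs)) L B →
  W w Q? (tuples (suc L) B) ≡ Σ< (suc B) (λ x → W w Q? (map (x ∷_) (tuples L B)))
W-tuples-suc w Q? L B =
  trans (W-concatMap w Q? (λ x → map (x ∷_) (tuples L B)) (upTo (suc B))) (sum-upTo (suc B) _)

head≤total : ∀ x t m → x + t ≡ m → x ≤ m
head≤total x t m e = subst (x ≤_) e (m≤m+n x t)

tail≡total∸head : ∀ x t m → x + t ≡ m → t ≡ m ∸ x
tail≡total∸head x t m e = trans (sym (m+n∸m≡n x t)) (cong (_∸ x) e)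

head+tail≡total : ∀ x t m → x ≤ m → t ≡ m ∸ x → x + t ≡ m
head+tail≡total x t m le e = trans (cong (x +_) e) (m+[n∸m]≡n le)

length-filter-cons : ∀ {Q : ℕ → Set} (Q? : (y : ℕ) → Dec (Q y)) x xs →
                     length (filter Q? (x ∷ xs)) ≡ ind (Q? x) + length (filter Q? xs)
length-filter-cons Q? x xs with Q? x
... | yes _ = refl
... | no _  = refl

-- Compositions with parts ≥ p = s + 1, and k "special" parts equal to s

module SpecialCompositions (s : ℕ) where

  p : ℕ
  p = suc s

  ordinary special : ℕ → ℕ
  ordinary i = ind (p ≤? i)
  special  i = ind (i ≟ s)

  ordinary-0 : ordinary 0 ≡ 0
  ordinary-0 = ind-no (p ≤? 0) (λ ())

  ordinary⇒¬special : ∀ {x} → p ≤ x → x ≡ s → ⊥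
  ordinary⇒¬special le refl = n≮n s le

  count-special : ∀ x xs → x ≡ s → count s (x ∷ xs) ≡ suc (count s xs)
  count-special x xs e = trans (length-filter-cons (_≟ s) x xs) (cong (_+ count s xs) (ind-yes (x ≟ s) e))

  count-ordinary : ∀ x xs → ¬ (x ≡ s) → count s (x ∷ xs) ≡ count s xs
  count-ordinary x xs ne = trans (length-filter-cons (_≟ s) x xs) (cong (_+ count s xs) (ind-no (x ≟ s) ne))

  ordinary-smaller : ∀ {m x k} → p ≤ x → x ≤ m → m ∸ x + k < m + k
  ordinary-smaller {suc m} {suc x} {k} (s≤s _) (s≤s _) = s≤s (+-monoˡ-≤ k (m∸n≤m m x))

  one : List ℕ → ℕ
  one _ = 1

  compsIn : ℕ → ℕ → ℕ → ℕ → ℕ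
  compsIn L B m k = W one (isComp′? m k p) (listsUpTo L B)

  -- Given counts N k m, the number of compositions of m with k special parts
  -- whose first part is x: a special x followed by k - 1 special parts,
  -- or an ordinary x followed by k special parts.
  firstPartTerm : (ℕ → ℕ → ℕ) → ℕ → ℕ → ℕ → ℕ
  firstPartTerm N zero    m x = ordinary x * N zero (m ∸ x)
  firstPartTerm N (suc k) m x = special x * N k (m ∸ x) + ordinary x * N (suc k) (m ∸ x)

  firstPartTerm-cong : ∀ (N N′ : ℕ → ℕ → ℕ) k m x → x ≤ m →
    (∀ k′ j → j ≤ m → j + k′ < m + k → N k′ j ≡ N′ k′ j) →
    firstPartTerm N k m x ≡ firstPartTerm N′ k m x
  firstPartTerm-cong N N′ zero    m x x≤m agree =
    ind-*-cong (p ≤? x) (λ px → agree 0 (m ∸ x) (m∸n≤m m x) (ordinary-smaller px x≤m))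
  firstPartTerm-cong N N′ (suc k) m x x≤m agree = cong₂ _+_
    (ind-*-cong (x ≟ s) (λ { refl → agree k (m ∸ s) (m∸n≤m m s) special-smaller }))
    (ind-*-cong (p ≤? x) (λ px → agree (suc k) (m ∸ x) (m∸n≤m m x) (ordinary-smaller px x≤m)))
    where
      special-smaller : m ∸ s + k < m + suc k
      special-smaller = subst (m ∸ s + k <_) (sym (+-suc m k)) (s≤s (+-monoˡ-≤ k (m∸n≤m m s)))

  compsIn-nil : ∀ m k → ind (isComp′? m k p []) * 1 ≡ δ m * δ k
  compsIn-nil zero    zero    = cong (_* 1) (ind-yes (isComp′? 0 0 p []) (refl , refl , []))
  compsIn-nil zero    (suc k) = cong (_* 1) (ind-no (isComp′? 0 (suc k) p []) (λ { (_ , () , _) }))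
  compsIn-nil (suc m) k       = cong (_* 1) (ind-no (isComp′? (suc m) k p []) (λ { (() , _) }))

  compsIn-zero : ∀ B m k → compsIn 0 B m k ≡ δ m * δ k
  compsIn-zero B m k = trans (W-cons one (isComp′? m k p) [] []) (trans (+-identityʳ _) (compsIn-nil m k))

  compsIn-first : ∀ L B m k x → W one (isComp′? m k p) (map (x ∷_) (listsUpTo L B)) ≡
                  ind (x ≤? m) * firstPartTerm (λ k′ j → compsIn L B j k′) k m x
  compsIn-first L B m zero x = begin
      W one (isComp′? m 0 p) (map (x ∷_) ys)
    ≡⟨ W-map one (isComp′? m 0 p) (x ∷_) ys ⟩
      W one (λ z → isComp′? m 0 p (x ∷ z)) ys
    ≡⟨ W-equiv one (λ z → isComp′? m 0 p (x ∷ z)) (λ z → (x ≤? m) ×-dec ((p ≤? x) ×-dec isComp′? (m ∸ x) 0 p z))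
               split join ys ⟩
      W one (λ z → (x ≤? m) ×-dec ((p ≤? x) ×-dec isComp′? (m ∸ x) 0 p z)) ys
    ≡⟨ W-and one (x ≤? m) (λ z → (p ≤? x) ×-dec isComp′? (m ∸ x) 0 p z) ys ⟩
      ind (x ≤? m) * W one (λ z → (p ≤? x) ×-dec isComp′? (m ∸ x) 0 p z) ys
    ≡⟨ cong (ind (x ≤? m) *_) (W-and one (p ≤? x) (isComp′? (m ∸ x) 0 p) ys) ⟩
      ind (x ≤? m) * (ordinary x * compsIn L B (m ∸ x) 0) ∎
    where
      open ≡-Reasoning
      ys = listsUpTo L B
      split : ∀ z → IsComp′ m 0 p (x ∷ z) → x ≤ m × (p ≤ x × IsComp′ (m ∸ x) 0 p z)
      split z (e , c0 , inj₁ x≡s ∷ az) with () ← trans (sym (count-special x z x≡s)) c0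
      split z (e , c0 , inj₂ px ∷ az) =
        head≤total x (sum z) m e , px , tail≡total∸head x (sum z) m e ,
        trans (sym (count-ordinary x z (ordinary⇒¬special px))) c0 , az
      join : ∀ z → x ≤ m × (p ≤ x × IsComp′ (m ∸ x) 0 p z) → IsComp′ m 0 p (x ∷ z)
      join z (le , px , e , c0 , az) =
        head+tail≡total x (sum z) m le e , trans (count-ordinary x z (ordinary⇒¬special px)) c0 , inj₂ px ∷ az
  compsIn-first L B m (suc k) x = begin
      W one (isComp′? m (suc k) p) (map (x ∷_) ys)
    ≡⟨ W-map one (isComp′? m (suc k) p) (x ∷_) ys ⟩
      W one (λ z → isComp′? m (suc k) p (x ∷ z)) ys
    ≡⟨ W-equiv one (λ z → isComp′? m (suc k) p (x ∷ z)) (λ z → (x ≤? m) ×-dec (Special? z ⊎-dec Ordinary? z))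
               split join ys ⟩
      W one (λ z → (x ≤? m) ×-dec (Special? z ⊎-dec Ordinary? z)) ys
    ≡⟨ W-and one (x ≤? m) (λ z → Special? z ⊎-dec Ordinary? z) ys ⟩
      ind (x ≤? m) * W one (λ z → Special? z ⊎-dec Ordinary? z) ys
    ≡⟨ cong (ind (x ≤? m) *_) (W-or one Special? Ordinary? (λ z sp or → ordinary⇒¬special (proj₁ or) (proj₁ sp)) ys) ⟩
      ind (x ≤? m) * (W one Special? ys + W one Ordinary? ys)
    ≡⟨ cong (ind (x ≤? m) *_) (cong₂ _+_ (W-and one (x ≟ s) (isComp′? (m ∸ x) k p) ys)
                                         (W-and one (p ≤? x) (isComp′? (m ∸ x) (suc k) p) ys)) ⟩
      ind (x ≤? m) * (special x * compsIn L B (m ∸ x) k + ordinary x * compsIn L B (m ∸ x) (suc k)) ∎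
    where
      open ≡-Reasoning
      ys = listsUpTo L B
      Special? = λ z → (x ≟ s) ×-dec isComp′? (m ∸ x) k p z
      Ordinary? = λ z → (p ≤? x) ×-dec isComp′? (m ∸ x) (suc k) p z
      Rest : List ℕ → Set
      Rest z = (x ≡ s × IsComp′ (m ∸ x) k p z) ⊎ (p ≤ x × IsComp′ (m ∸ x) (suc k) p z)
      split : ∀ z → IsComp′ m (suc k) p (x ∷ z) → x ≤ m × Rest z
      split z (e , ck , inj₁ x≡s ∷ az) = head≤total x (sum z) m e ,
        inj₁ (x≡s , tail≡total∸head x (sum z) m e , suc-injective (trans (sym (count-special x z x≡s)) ck) , az)
      split z (e , ck , inj₂ px ∷ az) = head≤total x (sum z) m e ,
        inj₂ (px , tail≡total∸head x (sum z) m e , trans (sym (count-ordinary x z (ordinary⇒¬special px))) ck , az)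
      join : ∀ z → x ≤ m × Rest z → IsComp′ m (suc k) p (x ∷ z)
      join z (le , inj₁ (x≡s , e , ck , az)) =
        head+tail≡total x (sum z) m le e , trans (count-special x z x≡s) (cong suc ck) , inj₁ x≡s ∷ az
      join z (le , inj₂ (px , e , ck , az)) =
        head+tail≡total x (sum z) m le e , trans (count-ordinary x z (ordinary⇒¬special px)) ck , inj₂ px ∷ az

  -- The first-part recursion for the bounded counts (the bound B ≥ m keeps
  -- every possible first entry x ≤ m in the enumeration).
  compsIn-suc : ∀ L B m k → m ≤ B →
    compsIn (suc L) B m k ≡ δ m * δ k + Σ< (suc m) (firstPartTerm (λ k′ j → compsIn L B j k′) k m)
  compsIn-suc L B m k m≤B = begin
      compsIn (suc L) B m k
    ≡⟨ W-listsUpTo-suc one (isComp′? m k p) L B ⟩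
      ind (isComp′? m k p []) * 1 + Σ< (suc B) (λ x → W one (isComp′? m k p) (map (x ∷_) (listsUpTo L B)))
    ≡⟨ cong₂ _+_ (compsIn-nil m k) (Σ<-cong (suc B) _ _ (λ x _ → compsIn-first L B m k x)) ⟩
      δ m * δ k + Σ< (suc B) (λ x → ind (x ≤? m) * firstPartTerm N k m x)
    ≡⟨ cong (δ m * δ k +_) (Σ<-restrict m B (firstPartTerm N k m) m≤B) ⟩
      δ m * δ k + Σ< (suc m) (firstPartTerm N k m) ∎
    where
      open ≡-Reasoning
      N = λ k′ j → compsIn L B j k′

  compsIn-suc-empty : ∀ L B → compsIn (suc L) B 0 0 ≡ 1
  compsIn-suc-empty L B = trans (compsIn-suc L B 0 0 z≤n) (cong (λ z → 1 + (z * compsIn L B 0 0 + 0)) ordinary-0)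

  -- The bounded count does not depend on the bounds once they are large
  -- enough: a composition of m with k special parts has at most m + k parts,
  -- each at most m.
  compsIn-bounds : ∀ L L′ B B′ m k → m + k ≤ L → m + k ≤ L′ → m ≤ B → m ≤ B′ →
                   compsIn L B m k ≡ compsIn L′ B′ m k
  compsIn-bounds zero    zero     B B′ zero zero _ _ _ _ = trans (compsIn-zero B 0 0) (sym (compsIn-zero B′ 0 0))
  compsIn-bounds zero    (suc L′) B B′ zero zero _ _ _ _ = trans (compsIn-zero B 0 0) (sym (compsIn-suc-empty L′ B′))
  compsIn-bounds (suc L) zero     B B′ zero zero _ _ _ _ = trans (compsIn-suc-empty L B) (sym (compsIn-zero B′ 0 0))
  compsIn-bounds (suc L) (suc L′) B B′ m k ≤L ≤L′ ≤B ≤B′ =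
    trans (compsIn-suc L B m k ≤B)
      (trans (cong (δ m * δ k +_) (Σ<-cong (suc m) _ _ (λ x lt →
                firstPartTerm-cong _ _ k m x (≤-pred lt) (λ k′ j j≤m smaller →
                  compsIn-bounds L L′ B B′ j k′ (shrink ≤L smaller) (shrink ≤L′ smaller)
                                 (≤-trans j≤m ≤B) (≤-trans j≤m ≤B′)))))
             (sym (compsIn-suc L′ B′ m k ≤B′)))
    where
      shrink : ∀ {a b L} → b ≤ suc L → a < b → a ≤ L
      shrink b≤ a<b = ≤-pred (≤-trans a<b b≤)

  D : ℕ → ℕ → ℕ
  D k m = c′ m k p

  C : ℕ → ℕ
  C m = c m p

  D≡compsIn : ∀ k m → D k m ≡ compsIn (m + k) m m k
  D≡compsIn k m = length-filter≡W (isComp′? m k p) (listsUpTo (m + k) m)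

  D-first : ∀ k m → D k m ≡ δ m * δ k + Σ< (suc m) (firstPartTerm D k m)
  D-first k m = begin
      D k m
    ≡⟨ D≡compsIn k m ⟩
      compsIn (m + k) m m k
    ≡⟨ compsIn-bounds (m + k) (suc (m + k)) m m m k ≤-refl (n≤1+n _) ≤-refl ≤-refl ⟩
      compsIn (suc (m + k)) m m k
    ≡⟨ compsIn-suc (m + k) m m k ≤-refl ⟩
      δ m * δ k + Σ< (suc m) (firstPartTerm (λ k′ j → compsIn (m + k) m j k′) k m)
    ≡⟨ cong (δ m * δ k +_) (Σ<-cong (suc m) _ _ (λ x lt →
         firstPartTerm-cong _ _ k m x (≤-pred lt) (λ k′ j j≤m smaller →
           trans (compsIn-bounds (m + k) (j + k′) m j j k′ (<⇒≤ smaller) ≤-refl j≤m ≤-refl)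
                 (sym (D≡compsIn k′ j))))) ⟩
      δ m * δ k + Σ< (suc m) (firstPartTerm D k m) ∎
    where open ≡-Reasoning

  all-ordinary⇒count≡0 : ∀ xs → All (p ≤_) xs → count s xs ≡ 0
  all-ordinary⇒count≡0 []       []          = refl
  all-ordinary⇒count≡0 (x ∷ xs) (px ∷ all≥) =
    trans (count-ordinary x xs (ordinary⇒¬special px)) (all-ordinary⇒count≡0 xs all≥)

  count≡0⇒all-ordinary : ∀ xs → count s xs ≡ 0 → All (λ x → x ≡ s ⊎ p ≤ x) xs → All (p ≤_) xs
  count≡0⇒all-ordinary []       _  []                = []
  count≡0⇒all-ordinary (x ∷ xs) c0 (inj₁ x≡s ∷ rest) with () ← trans (sym (count-special x xs x≡s)) c0
  count≡0⇒all-ordinary (x ∷ xs) c0 (inj₂ px ∷ rest)  =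
    px ∷ count≡0⇒all-ordinary xs (trans (sym (count-ordinary x xs (ordinary⇒¬special px))) c0) rest

  C≡D₀ : ∀ m → C m ≡ D 0 m
  C≡D₀ m = begin
      C m                                 ≡⟨ length-filter≡W (isComp? m p) (listsUpTo m m) ⟩
      W one (isComp? m p) (listsUpTo m m) ≡⟨ W-equiv one (isComp? m p) (isComp′? m 0 p)
           (λ xs (e , all≥) → e , all-ordinary⇒count≡0 xs all≥ , All-map inj₂ all≥)
           (λ xs (e , c0 , parts) → e , count≡0⇒all-ordinary xs c0 parts) (listsUpTo m m) ⟩
      compsIn m m m 0                     ≡⟨ cong (λ L → compsIn L m m 0) (sym (+-identityʳ m)) ⟩
      compsIn (m + 0) m m 0               ≡⟨ sym (D≡compsIn 0 m) ⟩
      D 0 m                               ∎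
    where open ≡-Reasoning

  D₀-rec : ∀ m → D 0 m ≡ δ m + (ordinary ⋆ D 0) m
  D₀-rec m = trans (D-first 0 m) (cong (_+ (ordinary ⋆ D 0) m) (*-identityʳ (δ m)))

  D-suc-rec : ∀ k m → D (suc k) m ≡ (special ⋆ D k) m + (ordinary ⋆ D (suc k)) m
  D-suc-rec k m = trans (D-first (suc k) m) (trans (cong (_+ Σ< (suc m) (firstPartTerm D (suc k) m)) (*-zeroʳ (δ m)))
    (Σ<-+ (suc m) (λ x → special x * D k (m ∸ x)) (λ x → ordinary x * D (suc k) (m ∸ x))))

  C-rec : ∀ m → C m ≡ δ m + (ordinary ⋆ C) m
  C-rec m = trans (C≡D₀ m) (trans (D₀-rec m)
    (cong (δ m +_) (⋆-cong m ordinary ordinary (D 0) C (λ _ _ → refl) (λ j _ → sym (C≡D₀ j)))))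

  -- C ⋆ A solves X = A + ordinary ⋆ X, since C = δ + ordinary ⋆ C.
  C⋆-solves : ∀ (A : ℕ → ℕ) m → (C ⋆ A) m ≡ A m + (ordinary ⋆ (C ⋆ A)) m
  C⋆-solves A m = begin
      (C ⋆ A) m                                ≡⟨ ⋆-cong m C _ A A (λ i _ → C-rec i) (λ _ _ → refl) ⟩
      ((λ i → δ i + (ordinary ⋆ C) i) ⋆ A) m   ≡⟨ ⋆-distribʳ-+ m δ (ordinary ⋆ C) A ⟩
      (δ ⋆ A) m + (ordinary ⋆ C ⋆ A) m         ≡⟨ cong₂ _+_ (⋆-identityˡ m A) (⋆-assoc m ordinary C A) ⟩
      A m + (ordinary ⋆ (C ⋆ A)) m             ∎
    where open ≡-Reasoning

  D-suc : ∀ k m → D (suc k) m ≡ (C ⋆ (special ⋆ D k)) m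
  D-suc k = ⋆-equation-unique ordinary (special ⋆ D k) (D (suc k)) (C ⋆ (special ⋆ D k))
              ordinary-0 (D-suc-rec k) (C⋆-solves (special ⋆ D k))

  special⋆-shift : ∀ (X : ℕ → ℕ) j → (special ⋆ X) (j + s) ≡ X j
  special⋆-shift X j = trans (Σ<-delta (suc (j + s)) s (λ i → X (j + s ∸ i)) (s≤s (m≤n+m s j)))
                             (cong X (m+n∸n≡m j s))

  special⋆-vanish : ∀ (X : ℕ → ℕ) t → (∀ j → j < t → X j ≡ 0) → ∀ m → m < s + t → (special ⋆ X) m ≡ 0
  special⋆-vanish X t X-vanish m m<s+t = Σ<-zero (suc m) _ (λ i i<1+m → term-vanish i (≤-pred i<1+m))
    where
      term-vanish : ∀ i → i ≤ m → special i * X (m ∸ i) ≡ 0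
      term-vanish i i≤m with i ≟ s
      ... | yes refl = trans (+-identityʳ _)
        (X-vanish (m ∸ s) (+-cancelˡ-< s (m ∸ s) t (subst (_< s + t) (sym (m+[n∸m]≡n i≤m)) m<s+t)))
      ... | no _     = refl

  D-vanish : ∀ k m → m < k * s → D k m ≡ 0
  D-vanish zero    m ()
  D-vanish (suc k) m m<ks = trans (D-suc k m) (⋆-zeroʳ m C (special ⋆ D k)
    (λ j j≤m → special⋆-vanish (D k) (k * s) (D-vanish k) j (≤-<-trans j≤m m<ks)))

  Cpow : ℕ → ℕ → ℕ
  Cpow zero    = δ
  Cpow (suc L) = C ⋆ Cpow L

  D-shifted : ∀ k M → D k (M + k * s) ≡ Cpow (suc k) M
  D-shifted zero    M = trans (cong (D 0) (+-identityʳ M)) (trans (sym (C≡D₀ M)) (sym (⋆-identityʳ M C)))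
  D-shifted (suc k) M = begin
      D (suc k) (M + (s + k * s))                    ≡⟨ D-suc k (M + (s + k * s)) ⟩
      (C ⋆ (special ⋆ D k)) (M + (s + k * s))        ≡⟨ cong (C ⋆ (special ⋆ D k)) (x+[y+z]≡x+z+y M s (k * s)) ⟩
      (C ⋆ (special ⋆ D k)) ((M + k * s) + s)        ≡⟨ ⋆-shift s (M + k * s) C (special ⋆ D k)
                                                          (λ j j<s → special⋆-vanish (D k) 0 (λ _ ()) j
                                                                       (subst (j <_) (sym (+-identityʳ s)) j<s)) ⟩
      (C ⋆ (λ j → (special ⋆ D k) (j + s))) (M + k * s) ≡⟨ ⋆-cong (M + k * s) C C _ (D k) (λ _ _ → refl)
                                                              (λ j _ → special⋆-shift (D k) j) ⟩
      (C ⋆ D k) (M + k * s)                          ≡⟨ ⋆-shift (k * s) M C (D k) (D-vanish k) ⟩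
      (C ⋆ (λ j → D k (j + k * s))) M                ≡⟨ ⋆-cong M C C _ _ (λ _ _ → refl) (λ j _ → D-shifted k j) ⟩
      Cpow (suc (suc k)) M                           ∎
    where
      open ≡-Reasoning
      x+[y+z]≡x+z+y : ∀ x y z → x + (y + z) ≡ x + z + y
      x+[y+z]≡x+z+y = solve-∀

  tupleWeight : List ℕ → ℕ
  tupleWeight is = product (map C is)

  tupleSum : ℕ → ℕ → ℕ → ℕ
  tupleSum L B t = W tupleWeight (λ is → sum is ≟ t) (tuples L B)

  tupleSum-zero : ∀ B t → tupleSum 0 B t ≡ δ t
  tupleSum-zero B t = trans (W-cons tupleWeight (λ is → sum is ≟ t) [] []) (trans (+-identityʳ _) (empty-tuple t))
    where
      empty-tuple : ∀ t → ind (0 ≟ t) * 1 ≡ δ t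
      empty-tuple zero    = cong (_* 1) (ind-yes (0 ≟ 0) refl)
      empty-tuple (suc t) = cong (_* 1) (ind-no (0 ≟ suc t) (λ ()))

  tupleSum-first : ∀ L B t x → W tupleWeight (λ is → sum is ≟ t) (map (x ∷_) (tuples L B)) ≡
                   ind (x ≤? t) * (C x * tupleSum L B (t ∸ x))
  tupleSum-first L B t x = begin
      W tupleWeight (λ is → sum is ≟ t) (map (x ∷_) ys)
    ≡⟨ W-map tupleWeight (λ is → sum is ≟ t) (x ∷_) ys ⟩
      W (λ z → C x * tupleWeight z) (λ z → x + sum z ≟ t) ys
    ≡⟨ W-equiv (λ z → C x * tupleWeight z) (λ z → x + sum z ≟ t) (λ z → (x ≤? t) ×-dec (sum z ≟ t ∸ x))
         (λ z e → head≤total x (sum z) t e , tail≡total∸head x (sum z) t e)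
         (λ z (le , e) → head+tail≡total x (sum z) t le e) ys ⟩
      W (λ z → C x * tupleWeight z) (λ z → (x ≤? t) ×-dec (sum z ≟ t ∸ x)) ys
    ≡⟨ W-and (λ z → C x * tupleWeight z) (x ≤? t) (λ z → sum z ≟ t ∸ x) ys ⟩
      ind (x ≤? t) * W (λ z → C x * tupleWeight z) (λ z → sum z ≟ t ∸ x) ys
    ≡⟨ cong (ind (x ≤? t) *_) (W-scale (C x) tupleWeight (λ z → sum z ≟ t ∸ x) ys) ⟩
      ind (x ≤? t) * (C x * tupleSum L B (t ∸ x)) ∎
    where
      open ≡-Reasoning
      ys = tuples L B

  tupleSum≡Cpow : ∀ L B t → t ≤ B → tupleSum L B t ≡ Cpow L t
  tupleSum≡Cpow zero    B t t≤B = tupleSum-zero B t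
  tupleSum≡Cpow (suc L) B t t≤B = begin
      tupleSum (suc L) B t
    ≡⟨ W-tuples-suc tupleWeight (λ is → sum is ≟ t) L B ⟩
      Σ< (suc B) (λ x → W tupleWeight (λ is → sum is ≟ t) (map (x ∷_) (tuples L B)))
    ≡⟨ Σ<-cong (suc B) _ _ (λ x _ → tupleSum-first L B t x) ⟩
      Σ< (suc B) (λ x → ind (x ≤? t) * (C x * tupleSum L B (t ∸ x)))
    ≡⟨ Σ<-restrict t B (λ x → C x * tupleSum L B (t ∸ x)) t≤B ⟩
      (C ⋆ tupleSum L B) t
    ≡⟨ ⋆-cong t C C _ _ (λ _ _ → refl) (λ j j≤t → tupleSum≡Cpow L B j (≤-trans j≤t t≤B)) ⟩
      Cpow (suc L) t ∎
    where open ≡-Reasoning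

-- The hypothesis 1 ≤ p lets us write p = s + 1.
proposition4 : (n p k : ℕ) → 1 ≤ n → 1 ≤ p →
    c′ (n + k * p + 1) k p ≡ rhs n k p
proposition4 n (suc s) k _ _ = begin
    c′ (n + k * suc s + 1) k (suc s)   ≡⟨ cong (D k) (size-split n k s) ⟩
    D k ((n + k + 1) + k * s)          ≡⟨ D-shifted k (n + k + 1) ⟩
    Cpow (suc k) (n + k + 1)           ≡⟨ sym (tupleSum≡Cpow (suc k) (n + k + 1) (n + k + 1) ≤-refl) ⟩
    rhs n k (suc s)                    ∎
  where
    open SpecialCompositions s
    open ≡-Reasoning
    size-split : ∀ n k s → n + k * suc s + 1 ≡ (n + k + 1) + k * s
    size-split n k s = trans (cong (λ z → n + z + 1) (*-suc k s)) (rearrange n k (k * s))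
      where
        rearrange : ∀ a b c → a + (b + c) + 1 ≡ a + b + 1 + c
        rearrange = solve-∀
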